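{- Let $n$ be a positive integer with $n\equiv 4\pmod 6$ and $n>2$, and let $H$ be a finite abelian group of order $n^2+n+1$ with identity $e$. Then there are no inverse-closed subsets $T_0,T_1\subseteq H$ with $e\in T_0$ and $|T_0|+|T_1|=2n+1$ satisfying in $\mathbb{Z}[H]$ $$T_0T_1=H-e\quad\text{and}\quad T_0^2+T_1^2=2H-T_0^{(2)}-T_1^{(2)}+2n\,e.$$
   Context: $\mathbb{Z}[H]$ is the group ring of $H$ over $\mathbb{Z}$; a subset $D\subseteq H$ is identified with $\sum_{d\in D}d$, and $H$ also denotes $\sum_{h\in H}h$. For $A=\sum a_h h$ and $t\in\mathbb{Z}$, $A^{(t)}=\sum a_h h^t$. A subset $D$ is inverse-closed if $D^{(-1)}=D$. -}

module Defs where

open import Data.Nat as ℕ using (ℕ; zero; suc)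
open import Data.Integer as ℤ using (ℤ; +_; -[1+_])
open import Data.Fin using (Fin; zero; suc)
open import Data.Fin.Properties using (_≟_)
open import Data.Fin.Subset using (Subset)
open import Data.Vec using (lookup)
open import Relation.Nullary using (does)
open import Relation.Binary.PropositionalEquality using (_≡_)
open import Algebra.Structures using (IsAbelianGroup)
open import Data.Bool using (if_then_else_)

-- A finite abelian group of order N, presented (up to isomorphism) on the
-- carrier Fin N with propositional equality.
record FinAbGroup (N : ℕ) : Set where
  field
    _∙_ : Fin N → Fin N → Fin N
    e   : Fin N
    _⁻¹ : Fin N → Fin N
    isAbelianGroup : IsAbelianGroup _≡_ _∙_ e _⁻¹

∑ : ∀ {N} → (Fin N → ℤ) → ℤ
∑ {zero}  f = + 0
∑ {suc N} f = f zero ℤ.+ ∑ (λ i → f (suc i))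

-- Group ring ℤ[H]: functions H → ℤ (coefficient of each group element).
ZH : ℕ → Set
ZH N = Fin N → ℤ

_≐_ : ∀ {N} → ZH N → ZH N → Set
A ≐ B = ∀ g → A g ≡ B g

module GroupRing {N : ℕ} (G : FinAbGroup N) where
  open FinAbGroup G

  powℕ : Fin N → ℕ → Fin N
  powℕ h zero    = e
  powℕ h (suc k) = h ∙ powℕ h k

  powℤ : Fin N → ℤ → Fin N
  powℤ h (+ k)      = powℕ h k
  powℤ h -[1+ k ]   = (powℕ h (suc k)) ⁻¹

  [_≟'_] : Fin N → Fin N → ℤ
  [ x ≟' y ] = if does (x ≟ y) then + 1 else + 0

  -- a subset D ⊆ H identified with ∑_{d ∈ D} d
  ⟦_⟧ : Subset N → ZH N
  ⟦ D ⟧ g = if lookup D g then + 1 else + 0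

  Hᵣ : ZH N
  Hᵣ g = + 1

  eᵣ : ZH N
  eᵣ g = [ g ≟' e ]

  _+ᵣ_ : ZH N → ZH N → ZH N
  (A +ᵣ B) g = A g ℤ.+ B g

  _-ᵣ_ : ZH N → ZH N → ZH N
  (A -ᵣ B) g = A g ℤ.- B g

  _·ᵣ_ : ℤ → ZH N → ZH N
  (k ·ᵣ A) g = k ℤ.* A g

  _*ᵣ_ : ZH N → ZH N → ZH N
  (A *ᵣ B) g = ∑ (λ h → A h ℤ.* B ((h ⁻¹) ∙ g))

  -- A^{(t)} = ∑ a_h h^t
  _⁽_⁾ : ZH N → ℤ → ZH N
  (A ⁽ t ⁾) g = ∑ (λ h → A h ℤ.* [ powℤ h t ≟' g ])

  InverseClosed : Subset N → Set
  InverseClosed D = (⟦ D ⟧ ⁽ ℤ.- (+ 1) ⁾) ≐ ⟦ D ⟧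

-- Since n ≡ 1 (mod 3), the order n² + n + 1 of H is divisible by 3. Counting the orbits
-- of the order-3 map (a , b) ↦ (b , (ab)⁻¹) on H × H then shows that cubing is not onto,
-- and enlarging the subgroup of cubes coset by coset until it has index 3 gives a
-- homomorphism φ from H onto C₃. The character h ↦ ζ^φ(h) takes integer values x, y on
-- the inverse-closed T₀, T₁, vanishes on H and agrees on T⁽²⁾ and T, so the group-ring
-- equations become xy = −1 and x² + y² = 2n − x − y. Hence {x , y} = {1 , −1} and n = 1.

module Submission where

open import Data.Nat.Base using (ℕ)
open import Data.Fin.Base using (Fin)
open import Relation.Binary.PropositionalEquality
open import Defs using (FinAbGroup; ∑; ZH; _≐_; module GroupRing)

module FiniteSums where

  open import Data.Nat.Base using (zero; suc)
  open import Data.Integer.Base using (ℤ; +_; _+_; _*_; -_; _-_; -1ℤ)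
  import Data.Integer.Properties as ℤ
  open import Data.Fin.Base using (zero; suc)
  open import Data.Fin.Properties using (_≟_)
  open import Data.Fin.Permutation using (permutation)
  open import Data.Bool.Base using (if_then_else_)
  open import Relation.Nullary using (does; yes; no; contradiction)
  open import Relation.Nullary.Decidable using (dec-true; dec-false)
  open import Algebra.Properties.CommutativeSemigroup ℤ.+-commutativeSemigroup using (interchange)
  open import Algebra.Properties.CommutativeMonoid.Sum ℤ.+-0-commutativeMonoid using (sum; sum-permute)

  -- Definitionally GroupRing.[_≟'_], the indicator inside eᵣ and _⁽_⁾.
  δ : ∀ {n} → Fin n → Fin n → ℤ
  δ x y = if does (x ≟ y) then + 1 else + 0

  δ-cong : ∀ {n} {x y u v : Fin n} → (x ≡ y → u ≡ v) → (u ≡ v → x ≡ y) → δ x y ≡ δ u v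
  δ-cong {x = x} {y} {u} {v} to from with x ≟ y | u ≟ v
  ... | yes _   | yes _   = refl
  ... | no _    | no _    = refl
  ... | yes x≡y | no u≢v  = contradiction (to x≡y) u≢v
  ... | no x≢y  | yes u≡v = contradiction (from u≡v) x≢y

  δ-yes : ∀ {n} {x y : Fin n} → x ≡ y → δ x y ≡ + 1
  δ-yes {x = x} {y} x≡y = cong (λ b → if b then + 1 else + 0) (dec-true (x ≟ y) x≡y)

  δ-no : ∀ {n} {x y : Fin n} → x ≢ y → δ x y ≡ + 0
  δ-no {x = x} {y} x≢y = cong (λ b → if b then + 1 else + 0) (dec-false (x ≟ y) x≢y)

  δ-comm : ∀ {n} (x y : Fin n) → δ x y ≡ δ y x
  δ-comm x y = δ-cong {x = x} {y} {y} {x} sym sym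

  ∑-cong : ∀ {n} {f g : Fin n → ℤ} → (∀ i → f i ≡ g i) → ∑ f ≡ ∑ g
  ∑-cong {zero}  f≗g = refl
  ∑-cong {suc n} f≗g = cong₂ _+_ (f≗g zero) (∑-cong (λ i → f≗g (suc i)))

  ∑-zero : ∀ {n} → ∑ {n} (λ _ → + 0) ≡ + 0
  ∑-zero {zero}  = refl
  ∑-zero {suc n} = trans (ℤ.+-identityˡ _) (∑-zero {n})

  ∑-const : ∀ {n} c → ∑ {n} (λ _ → c) ≡ + n * c
  ∑-const {zero}  c = sym (ℤ.*-zeroˡ c)
  ∑-const {suc n} c = begin
    c + ∑ {n} (λ _ → c)  ≡⟨ cong₂ _+_ (sym (ℤ.*-identityˡ c)) (∑-const {n} c) ⟩
    + 1 * c + + n * c    ≡⟨ ℤ.*-distribʳ-+ c (+ 1) (+ n) ⟨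
    + suc n * c          ∎
    where open ≡-Reasoning

  ∑-distrib-+ : ∀ {n} (f g : Fin n → ℤ) → ∑ (λ i → f i + g i) ≡ ∑ f + ∑ g
  ∑-distrib-+ {zero}  f g = refl
  ∑-distrib-+ {suc n} f g =
    trans (cong (_+_ (f zero + g zero)) (∑-distrib-+ (λ i → f (suc i)) (λ i → g (suc i))))
          (interchange (f zero) (g zero) _ _)

  *-distribˡ-∑ : ∀ {n} c (f : Fin n → ℤ) → c * ∑ f ≡ ∑ (λ i → c * f i)
  *-distribˡ-∑ {zero}  c f = ℤ.*-zeroʳ c
  *-distribˡ-∑ {suc n} c f =
    trans (ℤ.*-distribˡ-+ c (f zero) _) (cong (_+_ (c * f zero)) (*-distribˡ-∑ c (λ i → f (suc i))))

  *-distribʳ-∑ : ∀ {n} c (f : Fin n → ℤ) → ∑ f * c ≡ ∑ (λ i → f i * c)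
  *-distribʳ-∑ c f =
    trans (ℤ.*-comm (∑ f) c) (trans (*-distribˡ-∑ c f) (∑-cong (λ i → ℤ.*-comm c (f i))))

  ∑-neg : ∀ {n} (f : Fin n → ℤ) → ∑ (λ i → - f i) ≡ - ∑ f
  ∑-neg f = begin
    ∑ (λ i → - f i)     ≡⟨ ∑-cong (λ i → ℤ.-1*i≡-i (f i)) ⟨
    ∑ (λ i → -1ℤ * f i) ≡⟨ *-distribˡ-∑ -1ℤ f ⟨
    -1ℤ * ∑ f           ≡⟨ ℤ.-1*i≡-i (∑ f) ⟩
    - ∑ f               ∎
    where open ≡-Reasoning

  ∑-distrib‿- : ∀ {n} (f g : Fin n → ℤ) → ∑ (λ i → f i - g i) ≡ ∑ f - ∑ g
  ∑-distrib‿- f g = trans (∑-distrib-+ f (λ i → - g i)) (cong (_+_ (∑ f)) (∑-neg g))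

  ∑-comm : ∀ {m n} (f : Fin m → Fin n → ℤ) → ∑ (λ i → ∑ (f i)) ≡ ∑ (λ j → ∑ (λ i → f i j))
  ∑-comm {zero}  {n} f = sym (∑-zero {n})
  ∑-comm {suc m} f =
    trans (cong (_+_ (∑ (f zero))) (∑-comm (λ i → f (suc i))))
          (sym (∑-distrib-+ (f zero) (λ j → ∑ (λ i → f (suc i) j))))

  ∑-δ : ∀ {n} (a : Fin n) (f : Fin n → ℤ) → ∑ (λ x → δ x a * f x) ≡ f a
  ∑-δ {suc n} zero    f = trans (cong₂ _+_ (ℤ.*-identityˡ (f zero)) (∑-zero {n})) (ℤ.+-identityʳ (f zero))
  ∑-δ {suc n} (suc a) f = trans (ℤ.+-identityˡ _) (∑-δ a (λ x → f (suc x)))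

  ∑-δ≡1 : ∀ {n} (a : Fin n) → ∑ (λ x → δ a x) ≡ + 1
  ∑-δ≡1 a = trans (∑-cong (λ x → trans (δ-comm a x) (sym (ℤ.*-identityʳ (δ x a))))) (∑-δ a (λ _ → + 1))

  ∑≡sum : ∀ {n} (f : Fin n → ℤ) → ∑ f ≡ sum f
  ∑≡sum {zero}  f = refl
  ∑≡sum {suc n} f = cong (_+_ (f zero)) (∑≡sum (λ i → f (suc i)))

  ∑-bijection : ∀ {n} (f : Fin n → ℤ) (π π⁻¹ : Fin n → Fin n) →
                (∀ x → π (π⁻¹ x) ≡ x) → (∀ x → π⁻¹ (π x) ≡ x) → ∑ (λ i → f (π i)) ≡ ∑ f
  ∑-bijection f π π⁻¹ ππ⁻¹ π⁻¹π = begin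
    ∑ (λ i → f (π i))    ≡⟨ ∑≡sum (λ i → f (π i)) ⟩
    sum (λ i → f (π i))  ≡⟨ sum-permute f (permutation π π⁻¹ ππ⁻¹ π⁻¹π) ⟨
    sum f                ≡⟨ ∑≡sum f ⟨
    ∑ f                  ∎
    where open ≡-Reasoning

  ∑-exchange : ∀ {m n} (A : Fin m → ℤ) (K : Fin m → Fin n → ℤ) (w : Fin n → ℤ) →
               ∑ (λ g → ∑ (λ h → A h * K h g) * w g) ≡ ∑ (λ h → A h * ∑ (λ g → K h g * w g))
  ∑-exchange A K w = begin
    ∑ (λ g → ∑ (λ h → A h * K h g) * w g)
      ≡⟨ ∑-cong (λ g → *-distribʳ-∑ (w g) (λ h → A h * K h g)) ⟩
    ∑ (λ g → ∑ (λ h → A h * K h g * w g))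
      ≡⟨ ∑-comm (λ h g → A h * K h g * w g) ⟨
    ∑ (λ h → ∑ (λ g → A h * K h g * w g))
      ≡⟨ ∑-cong (λ h → ∑-cong (λ g → ℤ.*-assoc (A h) (K h g) (w g))) ⟩
    ∑ (λ h → ∑ (λ g → A h * (K h g * w g)))
      ≡⟨ ∑-cong (λ h → *-distribˡ-∑ (A h) (λ g → K h g * w g)) ⟨
    ∑ (λ h → A h * ∑ (λ g → K h g * w g)) ∎
    where open ≡-Reasoning

module IntegerFacts where

  import Data.Nat.Base as ℕ
  import Data.Nat.Properties as ℕ
  open import Data.Integer.Base using (ℤ; +_; 0ℤ; 1ℤ; -1ℤ; _+_; _*_; _-_; -_; +[1+_]; -[1+_]; ∣_∣)
  import Data.Integer.Properties as ℤ
  open import Data.Integer.Tactic.RingSolver using (solve-∀)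
  open import Data.Sum.Base using (_⊎_; inj₁; inj₂)
  open import Data.Nat.Divisibility using (divides; ∣1⇒≡1)

  x≡-x⇒x≡0 : ∀ x → x ≡ - x → x ≡ 0ℤ
  x≡-x⇒x≡0 (+ 0)    _  = refl
  x≡-x⇒x≡0 +[1+ n ] ()
  x≡-x⇒x≡0 -[1+ n ] ()

  ∣x∣≡1⇒x≡±1 : ∀ x → ∣ x ∣ ≡ 1 → x ≡ 1ℤ ⊎ x ≡ -1ℤ
  ∣x∣≡1⇒x≡±1 (+ .1)      refl = inj₁ refl
  ∣x∣≡1⇒x≡±1 -[1+ .0 ]   refl = inj₂ refl

  xy≡-1⇒x+y≡0 : ∀ x y → x * y ≡ -1ℤ → x + y ≡ 0ℤ
  xy≡-1⇒x+y≡0 x y xy≡-1 = units (∣x∣≡1⇒x≡±1 x ∣x∣≡1) (∣x∣≡1⇒x≡±1 y ∣y∣≡1) xy≡-1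
    where
    ∣x∣∣y∣≡1 : ∣ x ∣ ℕ.* ∣ y ∣ ≡ 1
    ∣x∣∣y∣≡1 = trans (sym (ℤ.abs-* x y)) (cong ∣_∣ xy≡-1)
    ∣x∣≡1 : ∣ x ∣ ≡ 1
    ∣x∣≡1 = ℕ.m*n≡1⇒m≡1 ∣ x ∣ ∣ y ∣ ∣x∣∣y∣≡1
    ∣y∣≡1 : ∣ y ∣ ≡ 1
    ∣y∣≡1 = ℕ.m*n≡1⇒n≡1 ∣ x ∣ ∣ y ∣ ∣x∣∣y∣≡1
    units : ∀ {x y} → x ≡ 1ℤ ⊎ x ≡ -1ℤ → y ≡ 1ℤ ⊎ y ≡ -1ℤ → x * y ≡ -1ℤ → x + y ≡ 0ℤ
    units (inj₁ refl) (inj₂ refl) _  = refl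
    units (inj₂ refl) (inj₁ refl) _  = refl
    units (inj₁ refl) (inj₁ refl) ()
    units (inj₂ refl) (inj₂ refl) ()

  3∣n⇒n²≢1+3l : ∀ n t l → n ≡ t * + 3 → n * n ≢ 1ℤ + + 3 * l
  3∣n⇒n²≢1+3l n t l n≡3t n²≡1+3l = 3≢1 (∣1⇒≡1 (divides ∣ t * n - l ∣ (begin
    1                            ≡⟨ cong ∣_∣ 3[tn-l]≡1 ⟨
    ∣ + 3 * (t * n - l) ∣        ≡⟨ ℤ.abs-* (+ 3) (t * n - l) ⟩
    3 ℕ.* ∣ t * n - l ∣          ≡⟨ ℕ.*-comm 3 ∣ t * n - l ∣ ⟩
    ∣ t * n - l ∣ ℕ.* 3          ∎)))
    where
    open ≡-Reasoning
    3≢1 : 3 ≢ 1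
    3≢1 ()
    expand : ∀ t n l → + 3 * (t * n - l) ≡ (t * + 3) * n - + 3 * l
    expand = solve-∀
    cancel : ∀ x y → (x + y) - y ≡ x
    cancel = solve-∀
    3[tn-l]≡1 : + 3 * (t * n - l) ≡ 1ℤ
    3[tn-l]≡1 = begin
      + 3 * (t * n - l)       ≡⟨ expand t n l ⟩
      (t * + 3) * n - + 3 * l ≡⟨ cong (λ m → m * n - + 3 * l) n≡3t ⟨
      n * n - + 3 * l         ≡⟨ cong (_- + 3 * l) n²≡1+3l ⟩
      (1ℤ + + 3 * l) - + 3 * l ≡⟨ cancel 1ℤ (+ 3 * l) ⟩
      1ℤ                      ∎

  xy≡-1∧x²+y²≡2n-x-y⇒n≡1 : ∀ n x y → x * y ≡ -1ℤ → x * x + y * y ≡ + (2 ℕ.* n) - x - y → n ≡ 1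
  xy≡-1∧x²+y²≡2n-x-y⇒n≡1 n x y xy≡-1 squares = ℕ.*-cancelˡ-≡ n 1 2 (ℤ.+-injective (begin
    + (2 ℕ.* n)                                  ≡⟨ add-back (+ (2 ℕ.* n)) x y ⟩
    (+ (2 ℕ.* n) - x - y) + (x + y)               ≡⟨ cong (_+ (x + y)) squares ⟨
    (x * x + y * y) + (x + y)                     ≡⟨ complete-square x y ⟩
    (x + y) * (x + y) + (x + y) - + 2 * (x * y)   ≡⟨ cong₂ (λ s p → s * s + s - + 2 * p) (xy≡-1⇒x+y≡0 x y xy≡-1) xy≡-1 ⟩
    + 2                                           ∎))
    where
    open ≡-Reasoning
    add-back : ∀ z x y → z ≡ (z - x - y) + (x + y)
    add-back = solve-∀
    complete-square : ∀ x y → (x * x + y * y) + (x + y) ≡ (x + y) * (x + y) + (x + y) - + 2 * (x * y)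
    complete-square = solve-∀

module LeastOfThree where

  open import Data.Nat.Base using (_<_)
  open import Data.Nat.Properties using (_<?_; <-cmp; <-asym; <-trans; <-irrefl)
  open import Data.Integer.Base using (ℤ; 0ℤ; 1ℤ; _+_; _*_)
  import Data.Integer.Properties as ℤ
  open import Data.Bool.Base using (if_then_else_)
  open import Data.Product.Base using (_×_; _,_)
  open import Data.Sum.Base using (_⊎_; inj₁; inj₂)
  open import Relation.Nullary using (¬_; does; contradiction)
  open import Relation.Nullary.Decidable using (dec-true; dec-false)
  open import Relation.Binary.Definitions using (tri<; tri≈; tri>)

  𝟙[_<_] : ℕ → ℕ → ℤ
  𝟙[ u < v ] = if does (u <? v) then 1ℤ else 0ℤ

  𝟙<-yes : ∀ {u v} → u < v → 𝟙[ u < v ] ≡ 1ℤ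
  𝟙<-yes {u} {v} u<v = cong (λ b → if b then 1ℤ else 0ℤ) (dec-true (u <? v) u<v)

  𝟙<-no : ∀ {u v} → ¬ u < v → 𝟙[ u < v ] ≡ 0ℤ
  𝟙<-no {u} {v} u≮v = cong (λ b → if b then 1ℤ else 0ℤ) (dec-false (u <? v) u≮v)

  least : ℕ → ℕ → ℕ → ℤ
  least u v w = 𝟙[ u < v ] * 𝟙[ u < w ]

  least-≡1 : ∀ {u v w} → u < v → u < w → least u v w ≡ 1ℤ
  least-≡1 u<v u<w = cong₂ _*_ (𝟙<-yes u<v) (𝟙<-yes u<w)

  least-self : ∀ u w → least u u w ≡ 0ℤ
  least-self u w = cong (_* 𝟙[ u < w ]) (𝟙<-no {u} {u} (<-irrefl refl))

  least-≡0ˡ : ∀ {u v} w → v < u → least u v w ≡ 0ℤ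
  least-≡0ˡ {u} {v} w v<u = cong (_* 𝟙[ u < w ]) (𝟙<-no {u} {v} (<-asym v<u))

  least-≡0ʳ : ∀ {u w} v → w < u → least u v w ≡ 0ℤ
  least-≡0ʳ {u} {w} v w<u = trans (cong (𝟙[ u < v ] *_) (𝟙<-no {u} {w} (<-asym w<u))) (ℤ.*-zeroʳ 𝟙[ u < v ])

  minimum : ∀ {u v w} → u ≢ v → v ≢ w → w ≢ u → (u < v × u < w) ⊎ (v < w × v < u) ⊎ (w < u × w < v)
  minimum {u} {v} {w} u≢v v≢w w≢u with <-cmp u v
  ... | tri≈ _ u≡v _ = contradiction u≡v u≢v
  ... | tri< u<v _ _ with <-cmp u w
  ...   | tri< u<w _ _ = inj₁ (u<v , u<w)
  ...   | tri≈ _ u≡w _ = contradiction (sym u≡w) w≢u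
  ...   | tri> _ _ w<u = inj₂ (inj₂ (w<u , <-trans w<u u<v))
  minimum {u} {v} {w} u≢v v≢w w≢u | tri> _ _ v<u with <-cmp v w
  ...   | tri< v<w _ _ = inj₂ (inj₁ (v<w , v<u))
  ...   | tri≈ _ v≡w _ = contradiction v≡w v≢w
  ...   | tri> _ _ w<v = inj₂ (inj₂ (<-trans w<v v<u , w<v))

  exactly-one-least : ∀ {u v w} → u ≢ v → v ≢ w → w ≢ u → least u v w + least v w u + least w u v ≡ 1ℤ
  exactly-one-least {u} {v} {w} u≢v v≢w w≢u with minimum u≢v v≢w w≢u
  ... | inj₁ (u<v , u<w)        = cong₂ _+_ (cong₂ _+_ (least-≡1 u<v u<w) (least-≡0ʳ w u<v)) (least-≡0ˡ v u<w)
  ... | inj₂ (inj₁ (v<w , v<u)) = cong₂ _+_ (cong₂ _+_ (least-≡0ˡ w v<u) (least-≡1 v<w v<u)) (least-≡0ʳ u v<w)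
  ... | inj₂ (inj₂ (w<u , w<v)) = cong₂ _+_ (cong₂ _+_ (least-≡0ʳ v w<u) (least-≡0ˡ u w<v)) (least-≡1 w<u w<v)

module DecidableSubsets {n : ℕ} where

  open import Data.Nat.Base using (_<_)
  open import Data.Fin.Subset using (Subset; _∈_; ∣_∣)
  open import Data.Fin.Subset.Properties using (p⊂q⇒∣p∣<∣q∣)
  open import Data.Vec.Base using (tabulate)
  open import Data.Vec.Properties using (lookup∘tabulate; lookup⇒[]=; []=⇒lookup)
  open import Data.Bool.Base using (true)
  open import Data.Product.Base using (_,_)
  open import Relation.Nullary using (¬_; Dec; yes; does)
  open import Relation.Nullary.Decidable using (dec-true)
  open import Relation.Unary using (Pred; Decidable)
  open import Level using (0ℓ)

  toSubset : {P : Pred (Fin n) 0ℓ} → Decidable P → Subset n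
  toSubset P? = tabulate (λ x → does (P? x))

  module _ {P : Pred (Fin n) 0ℓ} (P? : Decidable P) where

    ∈-toSubset⁺ : ∀ {x} → P x → x ∈ toSubset P?
    ∈-toSubset⁺ {x} px = lookup⇒[]= x _ (trans (lookup∘tabulate _ x) (dec-true (P? x) px))

    ∈-toSubset⁻ : ∀ {x} → x ∈ toSubset P? → P x
    ∈-toSubset⁻ {x} x∈ = witness (P? x) (trans (sym (lookup∘tabulate _ x)) ([]=⇒lookup x∈))
      where
      witness : ∀ {A : Set} (a? : Dec A) → does a? ≡ true → A
      witness (yes a) _ = a

  ∣toSubset∣-< : ∀ {P Q : Pred (Fin n) 0ℓ} (P? : Decidable P) (Q? : Decidable Q) →
                 (∀ {x} → P x → Q x) → ∀ {y} → Q y → ¬ P y → ∣ toSubset P? ∣ < ∣ toSubset Q? ∣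
  ∣toSubset∣-< P? Q? P⊆Q Qy ¬Py = p⊂q⇒∣p∣<∣q∣
    ( (λ x∈P → ∈-toSubset⁺ Q? (P⊆Q (∈-toSubset⁻ P? x∈P)))
    , _ , ∈-toSubset⁺ Q? Qy , (λ y∈P → ¬Py (∈-toSubset⁻ P? y∈P)))

module FinAbGroupProperties {N : ℕ} (G : FinAbGroup N) where

  open import Data.Integer.Base using (ℤ; +_; 1ℤ; _*_)
  import Data.Integer.Properties as ℤ
  open import Data.Fin.Properties using (nonZeroIndex)
  open import Data.Product.Base using (_,_; ∃)
  open import Level using (0ℓ)
  open import Algebra.Bundles using (AbelianGroup)
  open import Algebra.Structures using (IsAbelianGroup)
  import Algebra.Properties.AbelianGroup as AbelianGroupProperties
  import Algebra.Properties.CommutativeSemigroup as CommutativeSemigroupProperties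
  open FiniteSums

  open FinAbGroup G public
  open IsAbelianGroup isAbelianGroup public
    using (assoc; comm; identityˡ; identityʳ; inverseˡ; inverseʳ)

  abelianGroup : AbelianGroup 0ℓ 0ℓ
  abelianGroup = record { isAbelianGroup = isAbelianGroup }

  open AbelianGroupProperties abelianGroup public
    using (ε⁻¹≈ε; ⁻¹-involutive; ⁻¹-∙-comm; xyx⁻¹≈y; \\-leftDividesˡ; \\-leftDividesʳ;
           identityˡ-unique; identityʳ-unique; inverseˡ-unique; x∙y⁻¹≈ε⇒x≈y)
  open CommutativeSemigroupProperties (AbelianGroup.commutativeSemigroup abelianGroup) public
    using (interchange)

  cube : Fin N → Fin N
  cube x = x ∙ (x ∙ x)

  cube-∙ : ∀ x y → cube (x ∙ y) ≡ cube x ∙ cube y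
  cube-∙ x y = trans (cong ((x ∙ y) ∙_) (interchange x y x y)) (interchange x y _ _)

  [[xy]⁻¹x]⁻¹≡y : ∀ x y → (((x ∙ y) ⁻¹) ∙ x) ⁻¹ ≡ y
  [[xy]⁻¹x]⁻¹≡y x y = begin
    (((x ∙ y) ⁻¹) ∙ x) ⁻¹            ≡⟨ ⁻¹-∙-comm ((x ∙ y) ⁻¹) x ⟨
    (((x ∙ y) ⁻¹) ⁻¹) ∙ (x ⁻¹)       ≡⟨ cong (_∙ (x ⁻¹)) (⁻¹-involutive (x ∙ y)) ⟩
    (x ∙ y) ∙ (x ⁻¹)                 ≡⟨ xyx⁻¹≈y x y ⟩
    y                                ∎
    where open ≡-Reasoning

  ∑-translate : ∀ a (f : Fin N → ℤ) → ∑ (λ x → f (a ∙ x)) ≡ ∑ f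
  ∑-translate a f = ∑-bijection f (a ∙_) (a ⁻¹ ∙_) (\\-leftDividesˡ a) (\\-leftDividesʳ a)

  ∑-inverse : ∀ (f : Fin N → ℤ) → ∑ (λ x → f (x ⁻¹)) ≡ ∑ f
  ∑-inverse f = ∑-bijection f _⁻¹ _⁻¹ ⁻¹-involutive ⁻¹-involutive

  surjective-endomorphism⇒trivial-kernel : ∀ (f : Fin N → Fin N) → (∀ x y → f (x ∙ y) ≡ f x ∙ f y) →
                                           (∀ y → ∃ λ x → f x ≡ y) → ∑ (λ x → δ (f x) e) ≡ 1ℤ
  surjective-endomorphism⇒trivial-kernel f f-∙ onto =
    ℤ.*-cancelˡ-≡ (+ N) (fibre e) 1ℤ {{nonZeroIndex e}} (begin
      + N * fibre e                    ≡⟨ ∑-const {N} (fibre e) ⟨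
      ∑ {N} (λ _ → fibre e)            ≡⟨ ∑-cong (λ k → sym (fibres-equal k)) ⟩
      ∑ (λ k → fibre k)                ≡⟨ ∑-comm (λ k x → δ (f x) k) ⟩
      ∑ (λ x → ∑ (λ k → δ (f x) k))    ≡⟨ ∑-cong (λ x → ∑-δ≡1 (f x)) ⟩
      ∑ {N} (λ _ → 1ℤ)                 ≡⟨ ∑-const {N} 1ℤ ⟩
      + N * 1ℤ                         ∎)
    where
    open ≡-Reasoning
    fibre : Fin N → ℤ
    fibre k = ∑ λ x → δ (f x) k
    fibres-equal : ∀ k → fibre k ≡ fibre e
    fibres-equal k with onto k
    ... | x₀ , fx₀≡k = begin
      ∑ (λ x → δ (f x) k)           ≡⟨ ∑-translate x₀ (λ x → δ (f x) k) ⟨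
      ∑ (λ x → δ (f (x₀ ∙ x)) k)    ≡⟨ ∑-cong (λ x → δ-cong (to x) (from x)) ⟩
      ∑ (λ x → δ (f x) e)           ∎
      where
      to : ∀ x → f (x₀ ∙ x) ≡ k → f x ≡ e
      to x eq = identityʳ-unique k (f x) (trans (cong (_∙ f x) (sym fx₀≡k)) (trans (sym (f-∙ x₀ x)) eq))
      from : ∀ x → f x ≡ e → f (x₀ ∙ x) ≡ k
      from x eq = trans (f-∙ x₀ x) (trans (cong₂ _∙_ fx₀≡k eq) (identityʳ k))

module Homomorphism {M N : ℕ} (G : FinAbGroup M) (H : FinAbGroup N)
                    (φ : Fin M → Fin N)
                    (φ-∙ : ∀ x y → φ (FinAbGroup._∙_ G x y) ≡ FinAbGroup._∙_ H (φ x) (φ y)) where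

  private
    module G = FinAbGroupProperties G
    module H = FinAbGroupProperties H

  φ-e : φ G.e ≡ H.e
  φ-e = H.identityˡ-unique (φ G.e) (φ G.e) (trans (sym (φ-∙ G.e G.e)) (cong φ (G.identityˡ G.e)))

  φ-⁻¹ : ∀ x → φ (x G.⁻¹) ≡ (φ x) H.⁻¹
  φ-⁻¹ x = H.inverseˡ-unique (φ (x G.⁻¹)) (φ x)
    (trans (sym (φ-∙ (x G.⁻¹) x)) (trans (cong φ (G.inverseˡ x)) φ-e))

module CyclicGroupOfOrder3 where

  open import Data.Fin.Base using (zero; suc)
  open import Data.Fin.Properties using (_≟_; all?)
  open import Data.Integer.Base using (ℤ; 0ℤ; 1ℤ; -1ℤ; _*_; _-_; -_)
  import Data.Integer.Properties as ℤ
  open import Data.Product using (_,_)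
  open import Relation.Nullary.Decidable using (from-yes)
  open import Algebra.Structures using (IsAbelianGroup)

  pattern 0₃ = zero
  pattern 1₃ = suc zero
  pattern 2₃ = suc (suc zero)

  _⊕_ : Fin 3 → Fin 3 → Fin 3
  0₃ ⊕ j  = j
  1₃ ⊕ 0₃ = 1₃
  1₃ ⊕ 1₃ = 2₃
  1₃ ⊕ 2₃ = 0₃
  2₃ ⊕ 0₃ = 2₃
  2₃ ⊕ 1₃ = 0₃
  2₃ ⊕ 2₃ = 1₃

  ⊖_ : Fin 3 → Fin 3
  ⊖ 0₃ = 0₃
  ⊖ 1₃ = 2₃
  ⊖ 2₃ = 1₃

  C₃ : FinAbGroup 3
  C₃ = record
    { _∙_ = _⊕_
    ; e = 0₃
    ; _⁻¹ = ⊖_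
    ; isAbelianGroup = isAbelianGroup
    }
    where
    isAbelianGroup : IsAbelianGroup _≡_ _⊕_ 0₃ ⊖_
    isAbelianGroup = record
      { isGroup = record
        { isMonoid = record
          { isSemigroup = record
            { isMagma = record { isEquivalence = isEquivalence ; ∙-cong = cong₂ _⊕_ }
            ; assoc = from-yes (all? λ i → all? λ j → all? λ k → (i ⊕ j) ⊕ k ≟ i ⊕ (j ⊕ k))
            }
          ; identity = from-yes (all? λ i → 0₃ ⊕ i ≟ i) , from-yes (all? λ i → i ⊕ 0₃ ≟ i)
          }
        ; inverse = from-yes (all? λ i → (⊖ i) ⊕ i ≟ 0₃) , from-yes (all? λ i → i ⊕ (⊖ i) ≟ 0₃)
        ; ⁻¹-cong = cong ⊖_
        }
      ; comm = from-yes (all? λ i → all? λ j → i ⊕ j ≟ j ⊕ i)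
      }

  ⊕-double : ∀ i → i ⊕ i ≡ ⊖ i
  ⊕-double = from-yes (all? λ i → i ⊕ i ≟ ⊖ i)

  -- With ζ a primitive cube root of unity, ω j = Re ζʲ − ν j / 2 and ν j = (2/√3) Im ζʲ.
  -- Pairing with the odd function ν kills inverse-invariant elements, so on those the
  -- integer weight ω computes the character j ↦ ζʲ; ω-⊕ is the matching addition formula.
  ω ν : Fin 3 → ℤ
  ω 0₃ = 1ℤ
  ω 1₃ = -1ℤ
  ω 2₃ = 0ℤ
  ν 0₃ = 0ℤ
  ν 1₃ = 1ℤ
  ν 2₃ = -1ℤ

  ω-⊕ : ∀ i j → ω (i ⊕ j) ≡ ω i * ω j - ν i * ν j
  ω-⊕ = from-yes (all? λ i → all? λ j → ω (i ⊕ j) ℤ.≟ ω i * ω j - ν i * ν j)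

  ν-⊖ : ∀ i → ν (⊖ i) ≡ - ν i
  ν-⊖ = from-yes (all? λ i → ν (⊖ i) ℤ.≟ - ν i)

record HomOntoC₃ {N : ℕ} (G : FinAbGroup N) : Set where
  open FinAbGroup G
  open CyclicGroupOfOrder3 using (_⊕_; 1₃)
  field
    φ           : Fin N → Fin 3
    φ-∙         : ∀ x y → φ (x ∙ y) ≡ φ x ⊕ φ y
    generator   : Fin N
    φ-generator : φ generator ≡ 1₃

module CubeCounting {N : ℕ} (G : FinAbGroup N) where

  open import Data.Nat.Divisibility using (_∣_; divides)
  open import Data.Integer.Base using (ℤ; +_; 0ℤ; 1ℤ; _+_; _*_)
  import Data.Integer.Properties as ℤ
  open import Data.Integer.Tactic.RingSolver using (solve-∀)
  open import Data.Fin.Base using (toℕ; combine)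
  open import Data.Fin.Properties using (_≟_; toℕ-injective; combine-injective; any?; ¬∀⟶∃¬)
  open import Data.Product.Base using (_×_; _,_; proj₁; proj₂; ∃)
  open import Data.Sum.Base using (_⊎_; inj₁; inj₂)
  open import Relation.Nullary using (¬_; Dec; yes; no)
  open FiniteSums
  open IntegerFacts using (3∣n⇒n²≢1+3l)
  open LeastOfThree using (least; least-self; exactly-one-least)
  open FinAbGroupProperties G

  Pair : Set
  Pair = Fin N × Fin N

  ρ : Pair → Pair
  ρ (a , b) = b , (a ∙ b) ⁻¹

  ρ² : ∀ a b → ρ (ρ (a , b)) ≡ ((a ∙ b) ⁻¹ , a)
  ρ² a b = cong ((a ∙ b) ⁻¹ ,_) (begin
    (b ∙ ((a ∙ b) ⁻¹)) ⁻¹   ≡⟨ cong _⁻¹ (comm b ((a ∙ b) ⁻¹)) ⟩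
    (((a ∙ b) ⁻¹) ∙ b) ⁻¹   ≡⟨ cong (λ x → ((x ⁻¹) ∙ b) ⁻¹) (comm a b) ⟩
    (((b ∙ a) ⁻¹) ∙ b) ⁻¹   ≡⟨ [[xy]⁻¹x]⁻¹≡y b a ⟩
    a                       ∎)
    where open ≡-Reasoning

  ρ³ : ∀ p → ρ (ρ (ρ p)) ≡ p
  ρ³ (a , b) = trans (cong ρ (ρ² a b)) (cong (a ,_) ([[xy]⁻¹x]⁻¹≡y a b))

  ∑² : (Pair → ℤ) → ℤ
  ∑² F = ∑ λ a → ∑ λ b → F (a , b)

  ∑²-distrib-+ : ∀ F F′ → ∑² (λ p → F p + F′ p) ≡ ∑² F + ∑² F′
  ∑²-distrib-+ F F′ =
    trans (∑-cong (λ a → ∑-distrib-+ (λ b → F (a , b)) (λ b → F′ (a , b))))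
          (∑-distrib-+ (λ a → ∑ (λ b → F (a , b))) (λ a → ∑ (λ b → F′ (a , b))))

  ∑²-ρ : ∀ F → ∑² (λ p → F (ρ p)) ≡ ∑² F
  ∑²-ρ F = trans (∑-comm (λ a b → F (b , (a ∙ b) ⁻¹))) (∑-cong λ b → begin
    ∑ (λ a → F (b , (a ∙ b) ⁻¹))   ≡⟨ ∑-cong (λ a → cong (λ x → F (b , x ⁻¹)) (comm a b)) ⟩
    ∑ (λ a → F (b , (b ∙ a) ⁻¹))   ≡⟨ ∑-translate b (λ a → F (b , a ⁻¹)) ⟩
    ∑ (λ a → F (b , a ⁻¹))         ≡⟨ ∑-inverse (λ a → F (b , a)) ⟩
    ∑ (λ a → F (b , a))            ∎)
    where open ≡-Reasoning

  κ : Pair → ℕ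
  κ (a , b) = toℕ (combine a b)

  κ-injective : ∀ {p q} → κ p ≡ κ q → p ≡ q
  κ-injective {a , b} {c , d} eq with combine-injective a b c d (toℕ-injective eq)
  ... | refl , refl = refl

  -- Picks one representative from every ρ-orbit of size 3 (fixed points get 0).
  leader : Pair → ℤ
  leader p = least (κ p) (κ (ρ p)) (κ (ρ (ρ p)))

  leaders-of-moved-orbit : ∀ p → ρ p ≢ p → leader p + leader (ρ p) + leader (ρ (ρ p)) ≡ 1ℤ
  leaders-of-moved-orbit p moved =
    trans (cong₂ (λ q r → leader p + least (κ (ρ p)) (κ (ρ (ρ p))) (κ q) + least (κ (ρ (ρ p))) (κ q) (κ r))
                 (ρ³ p) (cong ρ (ρ³ p)))
          (exactly-one-least p≢ρp ρp≢ρ²p ρ²p≢p)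
    where
    p≢ρp : κ p ≢ κ (ρ p)
    p≢ρp eq = moved (sym (κ-injective eq))
    ρp≢ρ²p : κ (ρ p) ≢ κ (ρ (ρ p))
    ρp≢ρ²p eq = moved (sym (trans (sym (ρ³ p)) (trans (cong (λ q → ρ (ρ q)) (κ-injective eq)) (cong ρ (ρ³ p)))))
    ρ²p≢p : κ (ρ (ρ p)) ≢ κ p
    ρ²p≢p eq = moved (sym (trans (sym (ρ³ p)) (cong ρ (κ-injective eq))))

  leaders-of-fixed-point : ∀ p → ρ p ≡ p → leader p + leader (ρ p) + leader (ρ (ρ p)) ≡ 0ℤ
  leaders-of-fixed-point p fixed = begin
    leader p + leader (ρ p) + leader (ρ (ρ p))
      ≡⟨ cong₂ (λ q r → leader p + leader q + leader r) fixed (trans (cong ρ fixed) fixed) ⟩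
    leader p + leader p + leader p
      ≡⟨ cong (λ x → x + x + x) leader≡0 ⟩
    0ℤ ∎
    where
    open ≡-Reasoning
    leader≡0 : leader p ≡ 0ℤ
    leader≡0 = trans (cong (λ q → least (κ p) (κ q) (κ (ρ q))) fixed) (least-self (κ p) (κ (ρ p)))

  fixed : Pair → ℤ
  fixed (a , b) = δ b a * δ ((a ∙ b) ⁻¹) b

  fixed-indicator : ∀ p → (ρ p ≡ p × fixed p ≡ 1ℤ) ⊎ (ρ p ≢ p × fixed p ≡ 0ℤ)
  fixed-indicator (a , b) = cases (b ≟ a) ((a ∙ b) ⁻¹ ≟ b)
    where
    cases : Dec (b ≡ a) → Dec ((a ∙ b) ⁻¹ ≡ b) →
            (ρ (a , b) ≡ (a , b) × fixed (a , b) ≡ 1ℤ) ⊎ (ρ (a , b) ≢ (a , b) × fixed (a , b) ≡ 0ℤ)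
    cases (yes b≡a) (yes c≡b) = inj₁ (cong₂ _,_ b≡a c≡b , cong₂ _*_ (δ-yes b≡a) (δ-yes c≡b))
    cases (no b≢a)  _         = inj₂ ((λ eq → b≢a (cong proj₁ eq)) , cong (_* δ ((a ∙ b) ⁻¹) b) (δ-no b≢a))
    cases (yes _)   (no c≢b)  = inj₂ ((λ eq → c≢b (cong proj₂ eq)) ,
                                     trans (cong (δ b a *_) (δ-no c≢b)) (ℤ.*-zeroʳ (δ b a)))

  orbit-count : ∀ p → fixed p + (leader p + leader (ρ p) + leader (ρ (ρ p))) ≡ 1ℤ
  orbit-count p with fixed-indicator p
  ... | inj₁ (ρp≡p , fixed≡1) = cong₂ _+_ fixed≡1 (leaders-of-fixed-point p ρp≡p)
  ... | inj₂ (ρp≢p , fixed≡0) = cong₂ _+_ fixed≡0 (leaders-of-moved-orbit p ρp≢p)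

  ∑²-fixed : ∑² fixed ≡ ∑ (λ a → δ (cube a) e)
  ∑²-fixed = ∑-cong λ a → trans (∑-δ a (λ b → δ ((a ∙ b) ⁻¹) b)) (δ-cong (to a) (from a))
    where
    to : ∀ a → (a ∙ a) ⁻¹ ≡ a → cube a ≡ e
    to a eq = trans (cong (_∙ (a ∙ a)) (sym eq)) (inverseˡ (a ∙ a))
    from : ∀ a → cube a ≡ e → (a ∙ a) ⁻¹ ≡ a
    from a eq = sym (inverseˡ-unique a (a ∙ a) eq)

  orbit-decomposition : + N * + N ≡ ∑² fixed + + 3 * ∑² leader
  orbit-decomposition = begin
    + N * + N
      ≡⟨ trans (∑-cong {N} (λ _ → trans (∑-const {N} 1ℤ) (ℤ.*-identityʳ (+ N)))) (∑-const {N} (+ N)) ⟨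
    ∑² (λ _ → 1ℤ)
      ≡⟨ ∑-cong (λ a → ∑-cong (λ b → orbit-count (a , b))) ⟨
    ∑² (λ p → fixed p + (leader p + leader (ρ p) + leader (ρ (ρ p))))
      ≡⟨ ∑²-distrib-+ fixed (λ p → leader p + leader (ρ p) + leader (ρ (ρ p))) ⟩
    ∑² fixed + ∑² (λ p → leader p + leader (ρ p) + leader (ρ (ρ p)))
      ≡⟨ cong (_+_ (∑² fixed)) (trans (∑²-distrib-+ (λ p → leader p + leader (ρ p)) (λ p → leader (ρ (ρ p))))
                                   (cong (_+ ∑² (λ p → leader (ρ (ρ p)))) (∑²-distrib-+ leader (λ p → leader (ρ p))))) ⟩
    ∑² fixed + (∑² leader + ∑² (λ p → leader (ρ p)) + ∑² (λ p → leader (ρ (ρ p))))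
      ≡⟨ cong₂ (λ x y → ∑² fixed + (∑² leader + x + y)) (∑²-ρ leader) (trans (∑²-ρ (λ p → leader (ρ p))) (∑²-ρ leader)) ⟩
    ∑² fixed + (∑² leader + ∑² leader + ∑² leader)
      ≡⟨ cong (_+_ (∑² fixed)) (thrice (∑² leader)) ⟩
    ∑² fixed + + 3 * ∑² leader ∎
    where
    open ≡-Reasoning
    thrice : ∀ x → x + x + x ≡ + 3 * x
    thrice = solve-∀

  cubing-not-surjective : 3 ∣ N → ¬ (∀ y → ∃ λ x → cube x ≡ y)
  cubing-not-surjective (divides t N≡t*3) onto =
    3∣n⇒n²≢1+3l (+ N) (+ t) (∑² leader) (trans (cong +_ N≡t*3) (ℤ.pos-* t 3)) (begin
      + N * + N                      ≡⟨ orbit-decomposition ⟩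
      ∑² fixed + + 3 * ∑² leader     ≡⟨ cong (_+ + 3 * ∑² leader) ∑²-fixed ⟩
      ∑ (λ a → δ (cube a) e) + + 3 * ∑² leader
        ≡⟨ cong (_+ + 3 * ∑² leader) (surjective-endomorphism⇒trivial-kernel cube cube-∙ onto) ⟩
      1ℤ + + 3 * ∑² leader           ∎)
    where open ≡-Reasoning

  non-cube : 3 ∣ N → ∃ λ g → ¬ (∃ λ h → cube h ≡ g)
  non-cube 3∣N = ¬∀⟶∃¬ N _ (λ y → any? (λ x → cube x ≟ y)) (cubing-not-surjective 3∣N)

module SubgroupsContainingCubes {N : ℕ} (G : FinAbGroup N) where

  open import Data.Nat.Base using (zero; suc; _+_; _≤_; _<_)
  import Data.Nat.Properties as ℕ
  open import Data.Nat.Divisibility using (_∣_)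
  open import Data.Fin.Properties using (_≟_; any?; all?; ¬∀⟶∃¬)
  open import Data.Fin.Subset using (∣_∣)
  open import Data.Fin.Subset.Properties using (∣p∣≤n)
  open import Data.Product.Base using (_,_; proj₁; proj₂; ∃)
  open import Relation.Nullary using (¬_; yes; no; contradiction)
  open import Relation.Unary using (Pred; Decidable)
  open import Level using (0ℓ)
  open import Function.Base using (case_of_)
  open FinAbGroupProperties G
  open CyclicGroupOfOrder3
  open DecidableSubsets using (toSubset; ∣toSubset∣-<)
  open CubeCounting G using (non-cube)

  private
    module C = FinAbGroupProperties C₃

  record CubeContainingSubgroup : Set₁ where
    field
      Member   : Pred (Fin N) 0ℓ
      member?  : Decidable Member
      e∈       : Member e
      ∙-closed : ∀ {x y} → Member x → Member y → Member (x ∙ y)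
      cube∈    : ∀ x → Member (cube x)

  size : CubeContainingSubgroup → ℕ
  size S = ∣ toSubset (CubeContainingSubgroup.member? S) ∣

  size≤N : ∀ S → size S ≤ N
  size≤N S = ∣p∣≤n (toSubset (CubeContainingSubgroup.member? S))

  module Congruence (S : CubeContainingSubgroup) where

    open CubeContainingSubgroup S

    ⁻¹-closed : ∀ {x} → Member x → Member (x ⁻¹)
    ⁻¹-closed {x} x∈ = subst Member x∙[x∙cube[x⁻¹]]≡x⁻¹ (∙-closed x∈ (∙-closed x∈ (cube∈ (x ⁻¹))))
      where
      x∙[x∙cube[x⁻¹]]≡x⁻¹ : x ∙ (x ∙ cube (x ⁻¹)) ≡ x ⁻¹
      x∙[x∙cube[x⁻¹]]≡x⁻¹ = trans (cong (x ∙_) (\\-leftDividesˡ x ((x ⁻¹) ∙ (x ⁻¹)))) (\\-leftDividesˡ x (x ⁻¹))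

    infix 4 _~_
    _~_ : Fin N → Fin N → Set
    x ~ y = Member (x ∙ (y ⁻¹))

    ~-refl : ∀ {x} → x ~ x
    ~-refl {x} = subst Member (sym (inverseʳ x)) e∈

    ~-reflexive : ∀ {x y} → x ≡ y → x ~ y
    ~-reflexive refl = ~-refl

    ~-sym : ∀ {x y} → x ~ y → y ~ x
    ~-sym {x} {y} x~y = subst Member (begin
      (x ∙ (y ⁻¹)) ⁻¹          ≡⟨ ⁻¹-∙-comm x (y ⁻¹) ⟨
      (x ⁻¹) ∙ ((y ⁻¹) ⁻¹)     ≡⟨ cong ((x ⁻¹) ∙_) (⁻¹-involutive y) ⟩
      (x ⁻¹) ∙ y               ≡⟨ comm (x ⁻¹) y ⟩
      y ∙ (x ⁻¹)               ∎) (⁻¹-closed x~y)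
      where open ≡-Reasoning

    ~-trans : ∀ {x y z} → x ~ y → y ~ z → x ~ z
    ~-trans {x} {y} {z} x~y y~z = subst Member
      (trans (assoc x (y ⁻¹) (y ∙ (z ⁻¹))) (cong (x ∙_) (\\-leftDividesʳ y (z ⁻¹))))
      (∙-closed x~y y~z)

    ~-∙ : ∀ {x x′ y y′} → x ~ x′ → y ~ y′ → (x ∙ y) ~ (x′ ∙ y′)
    ~-∙ {x} {x′} {y} {y′} x~x′ y~y′ = subst Member
      (trans (interchange x (x′ ⁻¹) y (y′ ⁻¹)) (cong ((x ∙ y) ∙_) (⁻¹-∙-comm x′ y′)))
      (∙-closed x~x′ y~y′)

    ∈⇒~e : ∀ {x} → Member x → x ~ e
    ∈⇒~e {x} = subst Member (sym (trans (cong (x ∙_) ε⁻¹≈ε) (identityʳ x)))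

    ~e⇒∈ : ∀ {x} → x ~ e → Member x
    ~e⇒∈ {x} = subst Member (trans (cong (x ∙_) ε⁻¹≈ε) (identityʳ x))

    cube~e : ∀ x → cube x ~ e
    cube~e x = ∈⇒~e (cube∈ x)

  module Extension (S : CubeContainingSubgroup) (g : Fin N)
                   (g∉S : ¬ CubeContainingSubgroup.Member S g) where

    open CubeContainingSubgroup S
    open Congruence S

    power : Fin 3 → Fin N
    power 0₃ = e
    power 1₃ = g
    power 2₃ = g ∙ g

    power-⊕ : ∀ i j → (power i ∙ power j) ~ power (i ⊕ j)
    power-⊕ 0₃ j  = ~-reflexive (identityˡ (power j))
    power-⊕ 1₃ 0₃ = ~-reflexive (identityʳ g)
    power-⊕ 2₃ 0₃ = ~-reflexive (identityʳ (g ∙ g))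
    power-⊕ 1₃ 1₃ = ~-refl
    power-⊕ 1₃ 2₃ = cube~e g
    power-⊕ 2₃ 1₃ = ~-trans (~-reflexive (assoc g g g)) (cube~e g)
    power-⊕ 2₃ 2₃ = ~-trans (~-reflexive g²g²≡g³g) (~-trans (~-∙ (cube~e g) ~-refl) (~-reflexive (identityˡ g)))
      where
      g²g²≡g³g : (g ∙ g) ∙ (g ∙ g) ≡ cube g ∙ g
      g²g²≡g³g = trans (sym (assoc (g ∙ g) g g)) (cong (_∙ g) (assoc g g g))

    power∈⇒≡0₃ : ∀ i → Member (power i) → i ≡ 0₃
    power∈⇒≡0₃ 0₃ _    = refl
    power∈⇒≡0₃ 1₃ g∈S  = contradiction g∈S g∉S
    power∈⇒≡0₃ 2₃ g²∈S = contradiction (~e⇒∈ g~e) g∉S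
      where
      g~e : g ~ e
      g~e = ~-trans (~-reflexive (sym (identityʳ g)))
                    (~-trans (~-sym (~-∙ ~-refl (∈⇒~e g²∈S))) (cube~e g))

    power-injective : ∀ {i j} → power i ~ power j → i ≡ j
    power-injective {i} {j} pᵢ~pⱼ = C.x∙y⁻¹≈ε⇒x≈y i j (power∈⇒≡0₃ (i ⊕ (⊖ j)) (~e⇒∈
      (~-trans (~-sym (power-⊕ i (⊖ j)))
      (~-trans (~-∙ pᵢ~pⱼ ~-refl)
      (~-trans (power-⊕ j (⊖ j))
               (~-reflexive (cong power (C.inverseʳ j))))))))

    InCoset : Pred (Fin N) 0ℓ
    InCoset x = ∃ λ i → x ~ power i

    InCoset? : Decidable InCoset
    InCoset? x = any? (λ i → member? (x ∙ (power i ⁻¹)))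

    extension : CubeContainingSubgroup
    extension = record
      { Member   = InCoset
      ; member?  = InCoset?
      ; e∈       = 0₃ , ~-refl
      ; ∙-closed = λ (i , x~) (j , y~) → i ⊕ j , ~-trans (~-∙ x~ y~) (power-⊕ i j)
      ; cube∈    = λ x → 0₃ , cube~e x
      }

    size-grows : size S < size extension
    size-grows = ∣toSubset∣-< member? InCoset?
                              (λ x∈S → 0₃ , ∈⇒~e x∈S) (1₃ , ~-refl) g∉S

    quotient : (∀ x → InCoset x) → HomOntoC₃ G
    quotient covers = record
      { φ           = λ x → proj₁ (covers x)
      ; φ-∙         = λ x y → power-injective
          (~-trans (~-sym (proj₂ (covers (x ∙ y))))
          (~-trans (~-∙ (proj₂ (covers x)) (proj₂ (covers y))) (power-⊕ (proj₁ (covers x)) (proj₁ (covers y)))))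
      ; generator   = g
      ; φ-generator = power-injective (~-sym (proj₂ (covers g)))
      }

  grow : ∀ fuel S g → ¬ CubeContainingSubgroup.Member S g → N ≤ size S + fuel → HomOntoC₃ G
  grow fuel S g g∉S N≤size+fuel = case all? InCoset? of λ where
      (yes covers) → quotient covers
      (no ¬covers) → continue fuel N≤size+fuel (¬∀⟶∃¬ N InCoset InCoset? ¬covers)
    where
    open Extension S g g∉S
    continue : ∀ fuel → N ≤ size S + fuel → ∃ (λ x → ¬ InCoset x) → HomOntoC₃ G
    continue zero N≤size+0 _ =
      contradiction (subst (N ≤_) (ℕ.+-identityʳ (size S)) N≤size+0)
                    (ℕ.<⇒≱ (ℕ.<-≤-trans size-grows (size≤N extension)))
    continue (suc fuel′) N≤size+fuel (g′ , g′∉) = grow fuel′ extension g′ g′∉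
      (ℕ.≤-trans N≤size+fuel (ℕ.≤-trans (ℕ.≤-reflexive (ℕ.+-suc (size S) fuel′)) (ℕ.+-monoˡ-≤ fuel′ size-grows)))

  cubes : CubeContainingSubgroup
  cubes = record
    { Member   = λ x → ∃ λ h → cube h ≡ x
    ; member?  = λ x → any? (λ h → cube h ≟ x)
    ; e∈       = e , trans (identityˡ (e ∙ e)) (identityˡ e)
    ; ∙-closed = λ (h₁ , h₁³≡x) (h₂ , h₂³≡y) → h₁ ∙ h₂ , trans (cube-∙ h₁ h₂) (cong₂ _∙_ h₁³≡x h₂³≡y)
    ; cube∈    = λ x → x , refl
    }

  3∣N⇒homOntoC₃ : 3 ∣ N → HomOntoC₃ G
  3∣N⇒homOntoC₃ 3∣N = let g , g∉cubes = non-cube 3∣N in grow N cubes g g∉cubes (ℕ.m≤n+m N (size cubes))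

module GroupRingPairing {N : ℕ} (G : FinAbGroup N) where

  open import Data.Integer.Base using (ℤ; +_; _+_; _*_; _-_)
  open import Data.Integer.Tactic.RingSolver using (solve-∀)
  import Data.Integer.Properties as ℤ
  open FiniteSums
  open FinAbGroupProperties G
  open GroupRing G

  ⟨_,_⟩ : ZH N → (Fin N → ℤ) → ℤ
  ⟨ A , w ⟩ = ∑ λ h → A h * w h

  ⟨⟩-congˡ : ∀ {A B} w → A ≐ B → ⟨ A , w ⟩ ≡ ⟨ B , w ⟩
  ⟨⟩-congˡ w A≐B = ∑-cong (λ h → cong (_* w h) (A≐B h))

  ⟨⟩-congʳ : ∀ A {u w : Fin N → ℤ} → (∀ h → u h ≡ w h) → ⟨ A , u ⟩ ≡ ⟨ A , w ⟩
  ⟨⟩-congʳ A u≗w = ∑-cong (λ h → cong (A h *_) (u≗w h))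

  ⟨+ᵣ⟩ : ∀ A B w → ⟨ A +ᵣ B , w ⟩ ≡ ⟨ A , w ⟩ + ⟨ B , w ⟩
  ⟨+ᵣ⟩ A B w = trans (∑-cong (λ h → ℤ.*-distribʳ-+ (w h) (A h) (B h))) (∑-distrib-+ (λ h → A h * w h) (λ h → B h * w h))

  ⟨-ᵣ⟩ : ∀ A B w → ⟨ A -ᵣ B , w ⟩ ≡ ⟨ A , w ⟩ - ⟨ B , w ⟩
  ⟨-ᵣ⟩ A B w = trans (∑-cong (λ h → distrib (A h) (B h) (w h))) (∑-distrib‿- (λ h → A h * w h) (λ h → B h * w h))
    where
    distrib : ∀ a b c → (a - b) * c ≡ a * c - b * c
    distrib = solve-∀

  ⟨·ᵣ⟩ : ∀ c A w → ⟨ c ·ᵣ A , w ⟩ ≡ c * ⟨ A , w ⟩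
  ⟨·ᵣ⟩ c A w = trans (∑-cong (λ h → ℤ.*-assoc c (A h) (w h))) (sym (*-distribˡ-∑ c (λ h → A h * w h)))

  ⟨eᵣ⟩ : ∀ w → ⟨ eᵣ , w ⟩ ≡ w e
  ⟨eᵣ⟩ w = ∑-δ e w

  ⟨Hᵣ⟩ : ∀ w → ⟨ Hᵣ , w ⟩ ≡ ∑ w
  ⟨Hᵣ⟩ w = ∑-cong (λ h → ℤ.*-identityˡ (w h))

  ⟨⟩-linearʳ : ∀ A a b (u v : Fin N → ℤ) →
               ⟨ A , (λ h → a * u h - b * v h) ⟩ ≡ a * ⟨ A , u ⟩ - b * ⟨ A , v ⟩
  ⟨⟩-linearʳ A a b u v = begin
    ∑ (λ h → A h * (a * u h - b * v h))
      ≡⟨ ∑-cong (λ h → regroup (A h) a b (u h) (v h)) ⟩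
    ∑ (λ h → a * (A h * u h) - b * (A h * v h))
      ≡⟨ ∑-distrib‿- (λ h → a * (A h * u h)) (λ h → b * (A h * v h)) ⟩
    ∑ (λ h → a * (A h * u h)) - ∑ (λ h → b * (A h * v h))
      ≡⟨ cong₂ _-_ (*-distribˡ-∑ a (λ h → A h * u h)) (*-distribˡ-∑ b (λ h → A h * v h)) ⟨
    a * ⟨ A , u ⟩ - b * ⟨ A , v ⟩ ∎
    where
    open ≡-Reasoning
    regroup : ∀ x a b y z → x * (a * y - b * z) ≡ a * (x * y) - b * (x * z)
    regroup = solve-∀

  ⟨⁽⁾⟩ : ∀ A t w → ⟨ A ⁽ t ⁾ , w ⟩ ≡ ⟨ A , (λ h → w (powℤ h t)) ⟩
  ⟨⁽⁾⟩ A t w = trans (∑-exchange A (λ h g → δ (powℤ h t) g) w)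
    (∑-cong λ h → cong (A h *_)
      (trans (∑-cong (λ g → cong (_* w g) (δ-comm (powℤ h t) g))) (∑-δ (powℤ h t) w)))

  ⟨*ᵣ⟩ : ∀ A B w → ⟨ A *ᵣ B , w ⟩ ≡ ∑ (λ h → A h * ⟨ B , (λ y → w (h ∙ y)) ⟩)
  ⟨*ᵣ⟩ A B w = trans (∑-exchange A (λ h g → B ((h ⁻¹) ∙ g)) w)
    (∑-cong λ h → cong (A h *_) (sym (trans
      (∑-cong (λ y → cong (λ z → B z * w (h ∙ y)) (sym (\\-leftDividesʳ h y))))
      (∑-translate h (λ g → B ((h ⁻¹) ∙ g) * w g)))))

module Character {N : ℕ} {G : FinAbGroup N} (χ : HomOntoC₃ G) where

  import Data.Nat.Base as ℕ
  open import Data.Integer.Base using (ℤ; +_; 0ℤ; 1ℤ; -1ℤ; _+_; _*_; _-_; -_)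
  import Data.Integer.Properties as ℤ
  open import Data.Integer.Tactic.RingSolver using (solve-∀)
  open FiniteSums
  open IntegerFacts
  open FinAbGroupProperties G
  open GroupRing G
  open GroupRingPairing G
  open CyclicGroupOfOrder3
  open HomOntoC₃ χ
  open Homomorphism G C₃ φ φ-∙ using (φ-e; φ-⁻¹)

  Ψ : ZH N → ℤ
  Ψ A = ⟨ A , (λ h → ω (φ h)) ⟩

  InverseInvariant : ZH N → Set
  InverseInvariant B = ∀ w → ⟨ B , (λ h → w (h ⁻¹)) ⟩ ≡ ⟨ B , w ⟩

  inverseClosed⇒invariant : ∀ B → (B ⁽ - + 1 ⁾) ≐ B → InverseInvariant B
  inverseClosed⇒invariant B B⁻¹≐B w = begin
    ⟨ B , (λ h → w (h ⁻¹)) ⟩              ≡⟨ ⟨⟩-congʳ B (λ h → cong (λ x → w (x ⁻¹)) (sym (identityʳ h))) ⟩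
    ⟨ B , (λ h → w (powℤ h (- + 1))) ⟩    ≡⟨ ⟨⁽⁾⟩ B (- + 1) w ⟨
    ⟨ B ⁽ - + 1 ⁾ , w ⟩                   ≡⟨ ⟨⟩-congˡ w B⁻¹≐B ⟩
    ⟨ B , w ⟩                             ∎
    where open ≡-Reasoning

  Hᵣ-invariant : InverseInvariant Hᵣ
  Hᵣ-invariant w = trans (⟨Hᵣ⟩ (λ h → w (h ⁻¹))) (trans (∑-inverse w) (sym (⟨Hᵣ⟩ w)))

  ⟨ν∘φ⟩≡0 : ∀ B → InverseInvariant B → ⟨ B , (λ h → ν (φ h)) ⟩ ≡ 0ℤ
  ⟨ν∘φ⟩≡0 B invariant = x≡-x⇒x≡0 _ (begin
    ⟨ B , (λ h → ν (φ h)) ⟩         ≡⟨ invariant (λ h → ν (φ h)) ⟨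
    ⟨ B , (λ h → ν (φ (h ⁻¹))) ⟩    ≡⟨ ⟨⟩-congʳ B (λ h → trans (cong ν (φ-⁻¹ h)) (ν-⊖ (φ h))) ⟩
    ⟨ B , (λ h → - ν (φ h)) ⟩       ≡⟨ ∑-cong (λ h → ℤ.neg-distribʳ-* (B h) (ν (φ h))) ⟨
    ∑ (λ h → - (B h * ν (φ h)))     ≡⟨ ∑-neg (λ h → B h * ν (φ h)) ⟩
    - ⟨ B , (λ h → ν (φ h)) ⟩       ∎)
    where open ≡-Reasoning

  Ψ-translate : ∀ B → InverseInvariant B → ∀ h →
                ⟨ B , (λ y → ω (φ (h ∙ y))) ⟩ ≡ ω (φ h) * Ψ B
  Ψ-translate B invariant h = begin
    ⟨ B , (λ y → ω (φ (h ∙ y))) ⟩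
      ≡⟨ ⟨⟩-congʳ B (λ y → trans (cong ω (φ-∙ h y)) (ω-⊕ (φ h) (φ y))) ⟩
    ⟨ B , (λ y → ω (φ h) * ω (φ y) - ν (φ h) * ν (φ y)) ⟩
      ≡⟨ ⟨⟩-linearʳ B (ω (φ h)) (ν (φ h)) (λ y → ω (φ y)) (λ y → ν (φ y)) ⟩
    ω (φ h) * Ψ B - ν (φ h) * ⟨ B , (λ y → ν (φ y)) ⟩
      ≡⟨ cong (λ z → ω (φ h) * Ψ B - ν (φ h) * z) (⟨ν∘φ⟩≡0 B invariant) ⟩
    ω (φ h) * Ψ B - ν (φ h) * 0ℤ
      ≡⟨ drop (ω (φ h) * Ψ B) (ν (φ h)) ⟩
    ω (φ h) * Ψ B ∎
    where
    open ≡-Reasoning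
    drop : ∀ x y → x - y * 0ℤ ≡ x
    drop = solve-∀

  Ψ-*ᵣ : ∀ A B → InverseInvariant B → Ψ (A *ᵣ B) ≡ Ψ A * Ψ B
  Ψ-*ᵣ A B invariant = begin
    Ψ (A *ᵣ B)                            ≡⟨ ⟨*ᵣ⟩ A B (λ h → ω (φ h)) ⟩
    ∑ (λ h → A h * ⟨ B , (λ y → ω (φ (h ∙ y))) ⟩)
                                          ≡⟨ ∑-cong (λ h → cong (A h *_) (Ψ-translate B invariant h)) ⟩
    ∑ (λ h → A h * (ω (φ h) * Ψ B))       ≡⟨ ∑-cong (λ h → ℤ.*-assoc (A h) (ω (φ h)) (Ψ B)) ⟨
    ∑ (λ h → A h * ω (φ h) * Ψ B)         ≡⟨ *-distribʳ-∑ (Ψ B) (λ h → A h * ω (φ h)) ⟨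
    Ψ A * Ψ B                             ∎
    where open ≡-Reasoning

  Ψ-Hᵣ : Ψ Hᵣ ≡ 0ℤ
  Ψ-Hᵣ = x≡-x⇒x≡0 _ (begin
    Ψ Hᵣ                                         ≡⟨ ⟨Hᵣ⟩ (λ h → ω (φ h)) ⟩
    ∑ (λ h → ω (φ h))                            ≡⟨ ∑-translate generator (λ h → ω (φ h)) ⟨
    ∑ (λ y → ω (φ (generator ∙ y)))              ≡⟨ ⟨Hᵣ⟩ (λ y → ω (φ (generator ∙ y))) ⟨
    ⟨ Hᵣ , (λ y → ω (φ (generator ∙ y))) ⟩       ≡⟨ Ψ-translate Hᵣ Hᵣ-invariant generator ⟩
    ω (φ generator) * Ψ Hᵣ                       ≡⟨ cong (λ i → ω i * Ψ Hᵣ) φ-generator ⟩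
    -1ℤ * Ψ Hᵣ                                   ≡⟨ ℤ.-1*i≡-i (Ψ Hᵣ) ⟩
    - Ψ Hᵣ                                       ∎)
    where open ≡-Reasoning

  Ψ-eᵣ : Ψ eᵣ ≡ 1ℤ
  Ψ-eᵣ = trans (⟨eᵣ⟩ (λ h → ω (φ h))) (cong ω φ-e)

  Ψ-⁽²⁾ : ∀ A → InverseInvariant A → Ψ (A ⁽ + 2 ⁾) ≡ Ψ A
  Ψ-⁽²⁾ A invariant = begin
    Ψ (A ⁽ + 2 ⁾)                         ≡⟨ ⟨⁽⁾⟩ A (+ 2) (λ h → ω (φ h)) ⟩
    ⟨ A , (λ h → ω (φ (h ∙ (h ∙ e)))) ⟩   ≡⟨ ⟨⟩-congʳ A (λ h → cong ω (square≡inverse h)) ⟩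
    ⟨ A , (λ h → ω (φ (h ⁻¹))) ⟩          ≡⟨ invariant (λ h → ω (φ h)) ⟩
    Ψ A                                   ∎
    where
    open ≡-Reasoning
    square≡inverse : ∀ h → φ (h ∙ (h ∙ e)) ≡ φ (h ⁻¹)
    square≡inverse h = begin
      φ (h ∙ (h ∙ e))  ≡⟨ cong (λ x → φ (h ∙ x)) (identityʳ h) ⟩
      φ (h ∙ h)        ≡⟨ φ-∙ h h ⟩
      φ h ⊕ φ h        ≡⟨ ⊕-double (φ h) ⟩
      ⊖ φ h            ≡⟨ φ-⁻¹ h ⟨
      φ (h ⁻¹)         ∎

  equations⇒n≡1 : ∀ n A B → (A ⁽ - + 1 ⁾) ≐ A → (B ⁽ - + 1 ⁾) ≐ B →
    (A *ᵣ B) ≐ (Hᵣ -ᵣ eᵣ) →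
    ((A *ᵣ A) +ᵣ (B *ᵣ B)) ≐ (((((+ 2) ·ᵣ Hᵣ) -ᵣ (A ⁽ + 2 ⁾)) -ᵣ (B ⁽ + 2 ⁾)) +ᵣ ((+ (2 ℕ.* n)) ·ᵣ eᵣ)) →
    n ≡ 1
  equations⇒n≡1 n A B A-closed B-closed product-eq squares-eq =
    xy≡-1∧x²+y²≡2n-x-y⇒n≡1 n (Ψ A) (Ψ B) product squares
    where
    open ≡-Reasoning
    A-invariant : InverseInvariant A
    A-invariant = inverseClosed⇒invariant A A-closed
    B-invariant : InverseInvariant B
    B-invariant = inverseClosed⇒invariant B B-closed
    w : Fin N → ℤ
    w h = ω (φ h)

    product : Ψ A * Ψ B ≡ -1ℤ
    product = begin
      Ψ A * Ψ B     ≡⟨ Ψ-*ᵣ A B B-invariant ⟨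
      Ψ (A *ᵣ B)    ≡⟨ ⟨⟩-congˡ w product-eq ⟩
      Ψ (Hᵣ -ᵣ eᵣ)  ≡⟨ ⟨-ᵣ⟩ Hᵣ eᵣ w ⟩
      Ψ Hᵣ - Ψ eᵣ   ≡⟨ cong₂ _-_ Ψ-Hᵣ Ψ-eᵣ ⟩
      -1ℤ           ∎

    right-side : Ψ ((((+ 2) ·ᵣ Hᵣ) -ᵣ (A ⁽ + 2 ⁾)) -ᵣ (B ⁽ + 2 ⁾)) ≡ 0ℤ - Ψ A - Ψ B
    right-side = begin
      Ψ ((((+ 2) ·ᵣ Hᵣ) -ᵣ (A ⁽ + 2 ⁾)) -ᵣ (B ⁽ + 2 ⁾))
        ≡⟨ ⟨-ᵣ⟩ (((+ 2) ·ᵣ Hᵣ) -ᵣ (A ⁽ + 2 ⁾)) (B ⁽ + 2 ⁾) w ⟩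
      Ψ (((+ 2) ·ᵣ Hᵣ) -ᵣ (A ⁽ + 2 ⁾)) - Ψ (B ⁽ + 2 ⁾)
        ≡⟨ cong (_- Ψ (B ⁽ + 2 ⁾)) (⟨-ᵣ⟩ ((+ 2) ·ᵣ Hᵣ) (A ⁽ + 2 ⁾) w) ⟩
      Ψ ((+ 2) ·ᵣ Hᵣ) - Ψ (A ⁽ + 2 ⁾) - Ψ (B ⁽ + 2 ⁾)
        ≡⟨ cong₂ (λ a b → Ψ ((+ 2) ·ᵣ Hᵣ) - a - b) (Ψ-⁽²⁾ A A-invariant) (Ψ-⁽²⁾ B B-invariant) ⟩
      Ψ ((+ 2) ·ᵣ Hᵣ) - Ψ A - Ψ B
        ≡⟨ cong (λ z → z - Ψ A - Ψ B) (trans (⟨·ᵣ⟩ (+ 2) Hᵣ w) (cong (+ 2 *_) Ψ-Hᵣ)) ⟩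
      0ℤ - Ψ A - Ψ B ∎

    squares : Ψ A * Ψ A + Ψ B * Ψ B ≡ + (2 ℕ.* n) - Ψ A - Ψ B
    squares = begin
      Ψ A * Ψ A + Ψ B * Ψ B
        ≡⟨ cong₂ _+_ (Ψ-*ᵣ A A A-invariant) (Ψ-*ᵣ B B B-invariant) ⟨
      Ψ (A *ᵣ A) + Ψ (B *ᵣ B)
        ≡⟨ ⟨+ᵣ⟩ (A *ᵣ A) (B *ᵣ B) w ⟨
      Ψ ((A *ᵣ A) +ᵣ (B *ᵣ B))
        ≡⟨ ⟨⟩-congˡ w squares-eq ⟩
      Ψ (((((+ 2) ·ᵣ Hᵣ) -ᵣ (A ⁽ + 2 ⁾)) -ᵣ (B ⁽ + 2 ⁾)) +ᵣ ((+ (2 ℕ.* n)) ·ᵣ eᵣ))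
        ≡⟨ ⟨+ᵣ⟩ ((((+ 2) ·ᵣ Hᵣ) -ᵣ (A ⁽ + 2 ⁾)) -ᵣ (B ⁽ + 2 ⁾)) ((+ (2 ℕ.* n)) ·ᵣ eᵣ) w ⟩
      Ψ ((((+ 2) ·ᵣ Hᵣ) -ᵣ (A ⁽ + 2 ⁾)) -ᵣ (B ⁽ + 2 ⁾)) + Ψ ((+ (2 ℕ.* n)) ·ᵣ eᵣ)
        ≡⟨ cong₂ _+_ right-side (trans (⟨·ᵣ⟩ (+ (2 ℕ.* n)) eᵣ w) (cong (+ (2 ℕ.* n) *_) Ψ-eᵣ)) ⟩
      (0ℤ - Ψ A - Ψ B) + + (2 ℕ.* n) * 1ℤ
        ≡⟨ rearrange (Ψ A) (Ψ B) (+ (2 ℕ.* n)) ⟩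
      + (2 ℕ.* n) - Ψ A - Ψ B ∎
      where
      rearrange : ∀ x y z → (0ℤ - x - y) + z * 1ℤ ≡ z - x - y
      rearrange = solve-∀

open import Data.Nat using (_+_; _*_; _<_; _>_; _%_; s≤s)
open import Data.Nat.DivMod using (_/_; m≡m%n+[m/n]*n)
open import Data.Nat.Divisibility using (_∣_; divides)
open import Data.Nat.Tactic.RingSolver using (solve-∀)
open import Data.Integer using (+_)
open import Data.Fin.Subset using (Subset; _∈_; ∣_∣)
open import Data.Product using (∃₂; _×_; _,_)
open import Relation.Nullary using (¬_)

3∣n²+n+1 : ∀ n → n % 6 ≡ 4 → 3 ∣ n * n + n + 1
3∣n²+n+1 n n%6≡4 = divides (12 * q * q + 18 * q + 7) (begin
  n * n + n + 1                                ≡⟨ cong (λ m → m * m + m + 1) n≡4+6q ⟩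
  (4 + q * 6) * (4 + q * 6) + (4 + q * 6) + 1  ≡⟨ expand q ⟩
  (12 * q * q + 18 * q + 7) * 3                ∎)
  where
  open ≡-Reasoning
  q : ℕ
  q = n / 6
  n≡4+6q : n ≡ 4 + q * 6
  n≡4+6q = trans (m≡m%n+[m/n]*n n 6) (cong (_+ q * 6) n%6≡4)
  expand : ∀ q → (4 + q * 6) * (4 + q * 6) + (4 + q * 6) + 1 ≡ (12 * q * q + 18 * q + 7) * 3
  expand = solve-∀

theorem3p5 : (n : ℕ) → n > 0 → n % 6 ≡ 4 → n > 2 →
  (H : FinAbGroup (n * n + n + 1)) →
  let open FinAbGroup H
      open GroupRing H
  in ¬ ∃₂ λ (T₀ T₁ : Subset (n * n + n + 1)) →
       InverseClosed T₀ × InverseClosed T₁ × e ∈ T₀ ×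
       ∣ T₀ ∣ + ∣ T₁ ∣ ≡ 2 * n + 1 ×
       (⟦ T₀ ⟧ *ᵣ ⟦ T₁ ⟧) ≐ (Hᵣ -ᵣ eᵣ) ×
       ((⟦ T₀ ⟧ *ᵣ ⟦ T₀ ⟧) +ᵣ (⟦ T₁ ⟧ *ᵣ ⟦ T₁ ⟧))
         ≐ (((((+ 2) ·ᵣ Hᵣ) -ᵣ (⟦ T₀ ⟧ ⁽ + 2 ⁾)) -ᵣ (⟦ T₁ ⟧ ⁽ + 2 ⁾))
             +ᵣ ((+ (2 * n)) ·ᵣ eᵣ))
theorem3p5 n _ n%6≡4 n>2 H (T₀ , T₁ , T₀-closed , T₁-closed , _ , _ , product , squares) =
  2≮1 (subst (2 <_) n≡1 n>2)
  where
  open GroupRing H using (⟦_⟧)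
  χ : HomOntoC₃ H
  χ = SubgroupsContainingCubes.3∣N⇒homOntoC₃ H (3∣n²+n+1 n n%6≡4)
  n≡1 : n ≡ 1
  n≡1 = Character.equations⇒n≡1 χ n ⟦ T₀ ⟧ ⟦ T₁ ⟧ T₀-closed T₁-closed product squares
  2≮1 : ¬ 2 < 1
  2≮1 (s≤s ())
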